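{- Let $Q$ be finite, $\rho:Q\to\mathbb{N}$ with maximum $m$, $A$ a type, and $\mathcal{D}^k$, $\mathrm{fix}^k_A$ as in the context. For $k>0$ with $2k\le m$ and $f\in\mathcal{D}^{2k}_{A\to A}$: $\mathrm{fix}^{2k}_A(f)=\bigvee\{d\in\mathcal{D}^{2k}_A: f(d)\ge d \text{ and } d^\downarrow=\mathrm{fix}^{2k-1}_A(f^\downarrow)\}$. For $k>0$ with $2k+1\le m$ and $f\in\mathcal{D}^{2k+1}_{A\to A}$: $\mathrm{fix}^{2k+1}_A(f)=\bigwedge\{d\in\mathcal{D}^{2k+1}_A: f(d)\le d \text{ and } d^\downarrow=\mathrm{fix}^{2k}_A(f^\downarrow)\}$.
   Context: $Q_k=\{q:\rho(q)=k\}$, $Q_{\le k}=\{q:\rho(q)\le k\}$. $\mathcal{D}^0_o=\mathcal{P}(Q_0)$, $\mathcal{D}^0_{A\to B}$ = monotone maps $\mathcal{D}^0_A\to\mathcal{D}^0_B$; for $k>0$: $\mathcal{D}^k_o=\mathcal{P}(Q_{\le k})$, $\mathcal{L}^k_o=\{(R,P): R=P\cap Q_{\le k-1}\}$, $\mathcal{L}^k_{A\to B}=\{(f_1,f_2): f_1\in\mathcal{D}^{k-1}_{A\to B}$, $f_2$ monotone $\mathcal{D}^k_A\to\mathcal{D}^k_B$, $(f_1(g_1),f_2(g_2))\in\mathcal{L}^k_B$ whenever $(g_1,g_2)\in\mathcal{L}^k_A\}$, $\mathcal{D}^k_{A\to B}=\{f_2:\exists f_1,(f_1,f_2)\in\mathcal{L}^k_{A\to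 B}\}$; order: inclusion at $o$, pointwise at arrows; $\top^k_A$ greatest element. $e^\downarrow$ is the unique $d$ with $(d,e)\in\mathcal{L}^k_A$; $d^{\uparrow\top}$, $d^{\uparrow\bot}$ are the greatest and least $e$ with $(d,e)\in\mathcal{L}^k_A$. $\mathrm{fix}^0_A(f)=\bigwedge_n f^n(\top^0_A)$; $\mathrm{fix}^{2k}_A(f)=\bigwedge_n f^n((\mathrm{fix}^{2k-1}_A(f^\downarrow))^{\uparrow\top})$ for $2k>0$; $\mathrm{fix}^{2k+1}_A(f)=\bigvee_n f^n((\mathrm{fix}^{2k}_A(f^\downarrow))^{\uparrow\bot})$. -}

module Defs where

open import Data.Nat using (ℕ; zero; suc; _≤_; _≤?_; _+_; _*_)
open import Data.Fin using (Fin)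
open import Data.Fin.Subset using (Subset; _∈_; _⊆_; _∩_)
open import Data.Vec using (tabulate)
open import Data.Product using (Σ; _×_)
open import Data.Empty using (⊥)
open import Relation.Nullary using (does)
open import Relation.Binary.PropositionalEquality using (_≡_)

data Ty : Set where
  o   : Ty
  _⇒_ : Ty → Ty → Ty

infixr 5 _⇒_

iter : ∀ {X : Set} → ℕ → (X → X) → X → X
iter zero    f x = x
iter (suc n) f x = f (iter n f x)

module Domain (n : ℕ) (ρ : Fin n → ℕ) where

  -- raw (untyped-by-level) carriers; membership in D^k_A is a predicate
  Raw : Ty → Set
  Raw o       = Subset n
  Raw (A ⇒ B) = Raw A → Raw B

  Qle : ℕ → Subset n
  Qle k = tabulate (λ q → does (ρ q ≤? k))

  mutual
    D : ℕ → (A : Ty) → Raw A → Set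
    D zero    o       p = ∀ q → q ∈ p → ρ q ≡ 0
    D zero    (A ⇒ B) f = Mono zero A B f
    D (suc k) o       p = ∀ q → q ∈ p → ρ q ≤ suc k
    D (suc k) (A ⇒ B) f = Σ (Raw (A ⇒ B)) λ f₁ → L (suc k) (A ⇒ B) f₁ f

    Le : ℕ → (A : Ty) → Raw A → Raw A → Set
    Le k o       p p' = p ⊆ p'
    Le k (A ⇒ B) f g  = ∀ x → D k A x → Le k B (f x) (g x)

    Mono : ℕ → (A B : Ty) → Raw (A ⇒ B) → Set
    Mono k A B f = (∀ x → D k A x → D k B (f x))
                 × (∀ x y → D k A x → D k A y → Le k A x y → Le k B (f x) (f y))

    L : ℕ → (A : Ty) → Raw A → Raw A → Set
    L zero    A       _  _  = ⊥
    L (suc k) o       r  p  = D k o r × D (suc k) o p × r ≡ p ∩ Qle k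
    L (suc k) (A ⇒ B) f₁ f₂ = D k (A ⇒ B) f₁ × Mono (suc k) A B f₂
                            × (∀ g₁ g₂ → L (suc k) A g₁ g₂ → L (suc k) B (f₁ g₁) (f₂ g₂))

  Eq : ℕ → (A : Ty) → Raw A → Raw A → Set
  Eq k A x y = Le k A x y × Le k A y x

  IsTop : ℕ → (A : Ty) → Raw A → Set
  IsTop k A t = D k A t × (∀ x → D k A x → Le k A x t)

  -- e^↓ = d   (d is the unique element with (d , e) ∈ L^k_A)
  IsDown : ℕ → (A : Ty) → Raw A → Raw A → Set
  IsDown k A e d = L k A d e

  IsUpTop : ℕ → (A : Ty) → Raw A → Raw A → Set
  IsUpTop k A d e = L k A d e × (∀ e' → L k A d e' → Le k A e' e)

  IsUpBot : ℕ → (A : Ty) → Raw A → Raw A → Set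
  IsUpBot k A d e = L k A d e × (∀ e' → L k A d e' → Le k A e e')

  IsGlbFam : ℕ → (A : Ty) → (ℕ → Raw A) → Raw A → Set
  IsGlbFam k A s x = D k A x × (∀ i → Le k A x (s i))
                   × (∀ y → D k A y → (∀ i → Le k A y (s i)) → Le k A y x)

  IsLubFam : ℕ → (A : Ty) → (ℕ → Raw A) → Raw A → Set
  IsLubFam k A s x = D k A x × (∀ i → Le k A (s i) x)
                   × (∀ y → D k A y → (∀ i → Le k A (s i) y) → Le k A x y)

  IsGlb : ℕ → (A : Ty) → (Raw A → Set) → Raw A → Set
  IsGlb k A S x = D k A x × (∀ d → D k A d → S d → Le k A x d)
                × (∀ y → D k A y → (∀ d → D k A d → S d → Le k A y d) → Le k A y x)

  IsLub : ℕ → (A : Ty) → (Raw A → Set) → Raw A → Set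
  IsLub k A S x = D k A x × (∀ d → D k A d → S d → Le k A d x)
                × (∀ y → D k A y → (∀ d → D k A d → S d → Le k A d y) → Le k A x y)

  mutual
    -- IsFixE k A f x :  x = fix^{2k}_A(f)
    IsFixE : ℕ → (A : Ty) → Raw (A ⇒ A) → Raw A → Set
    IsFixE zero A f x =
      Σ (Raw A) λ t → IsTop 0 A t × IsGlbFam 0 A (λ i → iter i f t) x
    IsFixE (suc k) A f x =
      Σ (Raw (A ⇒ A)) λ g → Σ (Raw A) λ y → Σ (Raw A) λ u →
        IsDown (2 + 2 * k) (A ⇒ A) f g × IsFixO k A g y
        × IsUpTop (2 + 2 * k) A y u × IsGlbFam (2 + 2 * k) A (λ i → iter i f u) x

    -- IsFixO k A f x :  x = fix^{2k+1}_A(f)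
    IsFixO : ℕ → (A : Ty) → Raw (A ⇒ A) → Raw A → Set
    IsFixO k A f x =
      Σ (Raw (A ⇒ A)) λ g → Σ (Raw A) λ y → Σ (Raw A) λ u →
        IsDown (1 + 2 * k) (A ⇒ A) f g × IsFixE k A g y
        × IsUpBot (1 + 2 * k) A y u × IsLubFam (1 + 2 * k) A (λ i → iter i f u) x

module Submission where

-- Between consecutive levels every e ∈ D^{k+1} restricts to e^↓ ∈ D^k, and each d ∈ D^k has a
-- greatest and a least extension d^{↑⊤}, d^{↑⊥} in its fibre {e | e^↓ = d}.  If g = f^↓ and
-- g y = y, then f maps the fibre over y into itself, so the iterates of f starting at y^{↑⊤}
-- form a descending chain inside that fibre.  Since Q is finite, D^k_A is finite up to
-- equivalence (at arrow types by tabulating over a finite list of arguments), so by pigeonhole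
-- the chain becomes stationary: its limit is a fixpoint of f lying over y, and it dominates
-- every d ≤ f d over y because such d stays below every iterate.  The odd stages are the same
-- argument for the reversed order, starting at y^{↑⊥}.

open import Data.Bool using (Bool; true; false; T; _∧_)
open import Data.Empty using (⊥-elim)
open import Data.Fin as Fin using (Fin; toℕ; finToFun; funToFin)
open import Data.Fin.Properties using (pigeonhole; finToFun-funToFin)
open import Data.Fin.Subset using (Subset; _∩_; _∪_; _⊆_) renaming (_∈_ to _∈ˢ_; ⊥ to ∅)
open import Data.Fin.Subset.Properties
  using (⊆-antisym; ⊆-reflexive; _⊆?_; p∩q⊆p; ∉⊥; x∈p∩q⁺; x∈p∩q⁻; x∈p∪q⁺; x∈p∪q⁻)
open import Data.List as List using (List; []; _∷_; length; findIndexᵇ)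
open import Data.List.Membership.Propositional using (_∈_; find)
open import Data.List.Membership.Propositional.Properties using (∈-cartesianProductWith⁺; ∈-allFin)
open import Data.List.Relation.Unary.All as All using (All; []; _∷_)
open import Data.List.Relation.Unary.Any as Any using (Any; here; there)
open import Data.List.Relation.Unary.Any.Properties using (lookup-index; map⁺)
open import Data.Maybe as Maybe using (just)
open import Data.Nat as ℕ using (ℕ; zero; suc; z≤n; s≤s; _≤_; _≤?_; _≟_; _^_; _+_; _*_)
open import Data.Nat.Properties
  using (*-suc; n<1+n; n≤0⇒n≡0; ≤-reflexive; ≤-antisym; m≤n⇒m≤1+n; 1+n≰n; ≰⇒>)
open import Data.Product using (Σ; ∃; _×_; _,_; proj₁; proj₂; uncurry; swap)
open import Data.Sum using (inj₁; inj₂)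
open import Data.Unit using (tt)
open import Data.Vec using (tabulate) renaming (_∷_ to _∷ᵛ_; [] to []ᵛ)
open import Data.Vec.Properties using (lookup∘tabulate; lookup⇒[]=; []=⇒lookup)
open import Function using (_∘_)
open import Relation.Binary.PropositionalEquality using (_≡_; refl; sym; trans; cong; subst)
open import Relation.Nullary using (Dec; yes; no; does; proof; _because_)
open import Relation.Nullary.Decidable using (map′; _×-dec_; _→-dec_; T?; dec-true)
open import Relation.Nullary.Reflects using (Reflects; ofʸ; ofⁿ; _×-reflects_)
open import Relation.Unary using (Decidable)

open import Defs

select : ∀ {X : Set} {P : X → Set} → Decidable P → List X → List (Σ X P)
select P? []       = []
select P? (x ∷ xs) with P? x
... | yes px = (x , px) ∷ select P? xs
... | no  _  = select P? xs

select-complete : ∀ {X : Set} {P : X → Set} (P? : Decidable P) {x xs} →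
                  x ∈ xs → P x → Any ((x ≡_) ∘ proj₁) (select P? xs)
select-complete P? {xs = y ∷ xs} x∈ px with P? y | x∈
... | yes _ | here refl = here refl
... | yes _ | there x∈′ = there (select-complete P? x∈′ px)
... | no ¬py | here refl = ⊥-elim (¬py px)
... | no _  | there x∈′ = select-complete P? x∈′ px

findIndexᵇ-just : ∀ {X : Set} (p : X → Bool) {xs} → Any (T ∘ p) xs →
                  ∃ λ i → findIndexᵇ p xs ≡ just i × T (p (List.lookup xs i))
findIndexᵇ-just p {x ∷ xs} px∈ with p x in eq | px∈
... | true  | _         = Fin.zero , refl , subst T (sym eq) tt
... | false | here px   = ⊥-elim (subst T eq px)
... | false | there px∈′ with findIndexᵇ-just p px∈′
...   | i , found , pi = Fin.suc i , cong (Maybe.map Fin.suc) found , pi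

findIndexᵇ-cong : ∀ {X : Set} (p q : X → Bool) {xs} →
                  All (λ x → p x ≡ q x) xs → findIndexᵇ p xs ≡ findIndexᵇ q xs
findIndexᵇ-cong p q []                  = refl
findIndexᵇ-cong p q {x ∷ xs} (px≡qx ∷ rest)
  rewrite px≡qx | findIndexᵇ-cong p q rest = refl

subsets : ∀ m → List (Subset m)
subsets zero    = []ᵛ ∷ []
subsets (suc m) = List.cartesianProductWith _∷ᵛ_ (true ∷ false ∷ []) (subsets m)

∈-subsets : ∀ {m} (p : Subset m) → p ∈ subsets m
∈-subsets []ᵛ       = here refl
∈-subsets (b ∷ᵛ p) = ∈-cartesianProductWith⁺ _∷ᵛ_ (∈-booleans b) (∈-subsets p)
  where
    ∈-booleans : ∀ b → b ∈ true ∷ false ∷ []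
    ∈-booleans true  = here refl
    ∈-booleans false = there (here refl)

Reflects-T⁺ : ∀ {P : Set} {b} → Reflects P b → P → T b
Reflects-T⁺ (ofʸ _)  _ = tt
Reflects-T⁺ (ofⁿ ¬p) p = ¬p p

Reflects-T⁻ : ∀ {P : Set} {b} → Reflects P b → T b → P
Reflects-T⁻ (ofʸ p) _ = p

reflects-cong : ∀ {P Q : Set} {a b} → Reflects P a → Reflects Q b → (P → Q) → (Q → P) → a ≡ b
reflects-cong (ofʸ _)  (ofʸ _)  _   _   = refl
reflects-cong (ofʸ p)  (ofⁿ ¬q) P→Q _   = ⊥-elim (¬q (P→Q p))
reflects-cong (ofⁿ ¬p) (ofʸ q)  _   Q→P = ⊥-elim (¬p (Q→P q))
reflects-cong (ofⁿ _)  (ofⁿ _)  _   _   = refl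

module Iterates {X : Set} (P : X → Set) (_≤_ : X → X → Set)
                (≤-refl : ∀ {x} → x ≤ x)
                (≤-trans : ∀ {x y z} → x ≤ y → y ≤ z → x ≤ z) where

  _≈_ : X → X → Set
  x ≈ y = x ≤ y × y ≤ x

  Monotone : (X → X) → Set
  Monotone f = (∀ x → P x → P (f x)) × (∀ x y → P x → P y → x ≤ y → f x ≤ f y)

  Infimum : (ℕ → X) → X → Set
  Infimum s x = P x × (∀ i → x ≤ s i) × (∀ y → P y → (∀ i → y ≤ s i) → y ≤ x)

  Supremum : (X → Set) → X → Set
  Supremum S x = P x × (∀ d → P d → S d → d ≤ x)
               × (∀ y → P y → (∀ d → P d → S d → d ≤ y) → x ≤ y)

  Infimum-mono : ∀ {s s′ x x′} → (∀ i → s i ≤ s′ i) →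
                 Infimum s x → Infimum s′ x′ → x ≤ x′
  Infimum-mono s≤s′ (x-P , x≤s , _) (_ , _ , greatest′) =
    greatest′ _ x-P (λ i → ≤-trans (x≤s i) (s≤s′ i))

  iterate-closed : ∀ {f u} → Monotone f → P u → ∀ i → P (iter i f u)
  iterate-closed f-mono u-P zero    = u-P
  iterate-closed f-mono u-P (suc i) = proj₁ f-mono _ (iterate-closed f-mono u-P i)

  iterate-mono : ∀ {f f′ u u′} → Monotone f → Monotone f′ → P u → P u′ →
                 (∀ x → P x → f x ≤ f′ x) → u ≤ u′ →
                 ∀ i → iter i f u ≤ iter i f′ u′
  iterate-mono f-mono f′-mono u-P u′-P f≤f′ u≤u′ zero    = u≤u′
  iterate-mono f-mono f′-mono u-P u′-P f≤f′ u≤u′ (suc i) =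
    ≤-trans (proj₂ f-mono _ _ (iterate-closed f-mono u-P i) (iterate-closed f′-mono u′-P i)
                              (iterate-mono f-mono f′-mono u-P u′-P f≤f′ u≤u′ i))
            (f≤f′ _ (iterate-closed f′-mono u′-P i))

  module Descending {f u} (f-mono : Monotone f) (u-P : P u) (fu≤u : f u ≤ u) where

    private
      c : ℕ → X
      c i = iter i f u

      c-P : ∀ i → P (c i)
      c-P = iterate-closed f-mono u-P

      f-≤ : ∀ {x y} → P x → P y → x ≤ y → f x ≤ f y
      f-≤ = proj₂ f-mono _ _

    step-down : ∀ i → c (suc i) ≤ c i
    step-down zero    = fu≤u
    step-down (suc i) = f-≤ (c-P (suc i)) (c-P i) (step-down i)

    antitone : ∀ i j → i ℕ.≤ j → c j ≤ c i
    antitone zero    zero    z≤n       = ≤-refl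
    antitone zero    (suc j) z≤n       = ≤-trans (step-down j) (antitone 0 j z≤n)
    antitone (suc i) (suc j) (s≤s i≤j) = f-≤ (c-P j) (c-P i) (antitone i j i≤j)

    below-iterates : ∀ {d} → P d → d ≤ u → d ≤ f d → ∀ i → d ≤ c i
    below-iterates d-P d≤u d≤fd zero    = d≤u
    below-iterates d-P d≤u d≤fd (suc i) =
      ≤-trans d≤fd (f-≤ d-P (c-P i) (below-iterates d-P d≤u d≤fd i))

    stable⇒infimum : ∀ N → c N ≤ c (suc N) → Infimum c (c N)
    stable⇒infimum N stable = c-P N , below , λ y _ y≤c → y≤c N
      where
        below : ∀ i → c N ≤ c i
        below zero    = antitone 0 N z≤n
        below (suc i) = ≤-trans stable (f-≤ (c-P N) (c-P i) (below i))

    module Stabilisation (elements : List X) (complete : ∀ {x} → P x → Any (x ≈_) elements) where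

      -- Pigeonhole: among the first |elements| + 1 iterates two are equivalent,
      -- and an antitone chain is constant in between.
      stabilises : ∃ λ N → c N ≤ c (suc N)
      stabilises with pigeonhole (n<1+n (length elements)) (λ i → Any.index (complete (c-P (toℕ i))))
      ... | i , j , i<j , same =
        toℕ i , ≤-trans (proj₁ (lookup-index (complete (c-P (toℕ i)))))
                (≤-trans (subst (λ e → List.lookup elements e ≤ c (toℕ j)) (sym same)
                                (proj₂ (lookup-index (complete (c-P (toℕ j))))))
                         (antitone (suc (toℕ i)) (toℕ j) i<j))

      infimum-exists : ∃ (Infimum c)
      infimum-exists = let N , stable = stabilises in c N , stable⇒infimum N stable

      infimum-≈-iterate : ∀ {x} → Infimum c x → ∃ λ N → x ≈ c N × c N ≤ c (suc N)
      infimum-≈-iterate (x-P , x≤c , greatest) =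
        let N , stable = stabilises
            cN-P , cN≤c , _ = stable⇒infimum N stable
        in N , (x≤c N , greatest _ cN-P cN≤c) , stable

      infimum-fixed : ∀ {x} → Infimum c x → f x ≈ x
      infimum-fixed inf@(x-P , _ , _) =
        let N , (x≤cN , cN≤x) , stable = infimum-≈-iterate inf
        in  ≤-trans (f-≤ x-P (c-P N) x≤cN) (≤-trans (step-down N) cN≤x)
          , ≤-trans x≤cN (≤-trans stable (f-≤ (c-P N) x-P cN≤x))

      infimum-induction : (Q : X → Set) → (∀ {x y} → x ≈ y → Q x → Q y) →
                          Q u → (∀ {x} → P x → Q x → Q (f x)) →
                          ∀ {x} → Infimum c x → Q x
      infimum-induction Q Q-resp Q-u Q-f inf =
        let N , x≈cN , _ = infimum-≈-iterate inf
        in Q-resp (proj₂ x≈cN , proj₁ x≈cN) (Q-iterate N)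
        where
          Q-iterate : ∀ i → Q (c i)
          Q-iterate zero    = Q-u
          Q-iterate (suc i) = Q-f (c-P i) (Q-iterate i)

∈-tabulate⁺ : ∀ {n} {P : Fin n → Set} (P? : Decidable P) {q} → P q → q ∈ˢ tabulate (does ∘ P?)
∈-tabulate⁺ P? {q} pq = lookup⇒[]= q _ (trans (lookup∘tabulate (does ∘ P?) q) (dec-true (P? q) pq))

∈-tabulate⁻ : ∀ {n} {P : Fin n → Set} (P? : Decidable P) {q} → q ∈ˢ tabulate (does ∘ P?) → P q
∈-tabulate⁻ P? {q} q∈ with P? q | trans (sym (lookup∘tabulate (does ∘ P?) q)) ([]=⇒lookup q∈)
... | yes pq | _  = pq
... | no _   | ()

module Hierarchy (n : ℕ) (ρ : Fin n → ℕ) where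

  open Domain n ρ

  Le-refl : ∀ k A {x} → Le k A x x
  Le-refl k o       = λ q∈ → q∈
  Le-refl k (A ⇒ B) = λ _ _ → Le-refl k B

  Le-trans : ∀ k A {x y z} → Le k A x y → Le k A y z → Le k A x z
  Le-trans k o       x≤y y≤z = λ q∈ → y≤z (x≤y q∈)
  Le-trans k (A ⇒ B) f≤g g≤h = λ x x-D → Le-trans k B (f≤g x x-D) (g≤h x x-D)

  D⇒Mono : ∀ k A B {f} → D k (A ⇒ B) f → Mono k A B f
  D⇒Mono zero    A B f-D            = f-D
  D⇒Mono (suc k) A B (_ , _ , f-mono , _) = f-mono

  L-lower : ∀ k A {d e} → L (suc k) A d e → D k A d
  L-lower k o       (d-D , _) = d-D
  L-lower k (A ⇒ B) (d-D , _) = d-D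

  L-upper : ∀ k A {d e} → L (suc k) A d e → D (suc k) A e
  L-upper k o       (_ , e-D , _) = e-D
  L-upper k (A ⇒ B) {d} de-L     = d , de-L

  ∈-Qle⁺ : ∀ {k q} → ρ q ≤ k → q ∈ˢ Qle k
  ∈-Qle⁺ {k} = ∈-tabulate⁺ (λ q → ρ q ≤? k)

  ∈-Qle⁻ : ∀ {k q} → q ∈ˢ Qle k → ρ q ≤ k
  ∈-Qle⁻ {k} = ∈-tabulate⁻ (λ q → ρ q ≤? k)

  D-o⁺ : ∀ k {r} → (∀ q → q ∈ˢ r → ρ q ≤ k) → D k o r
  D-o⁺ zero    bounded q q∈ = n≤0⇒n≡0 (bounded q q∈)
  D-o⁺ (suc k) bounded      = bounded

  D-o⁻ : ∀ k {r} → D k o r → ∀ q → q ∈ˢ r → ρ q ≤ k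
  D-o⁻ zero    r-D q q∈ = ≤-reflexive (r-D q q∈)
  D-o⁻ (suc k) r-D      = r-D

  mutual
    D-resp-Eq : ∀ k A {x y} → D k A x → Eq k A x y → D k A y
    D-resp-Eq k       o       x-D (_ , y⊆x)    = D-o⁺ k (λ q q∈ → D-o⁻ k x-D q (y⊆x q∈))
    D-resp-Eq zero    (A ⇒ B) f-D f≈g          = Mono-resp-Eq zero A B f-D f≈g
    D-resp-Eq (suc k) (A ⇒ B) (f₁ , f₁f-L) f≈g = f₁ , L-respʳ-Eq k (A ⇒ B) f₁f-L f≈g

    Mono-resp-Eq : ∀ k A B {f g} → Mono k A B f → Eq k (A ⇒ B) f g → Mono k A B g
    Mono-resp-Eq k A B (f-D , f-≤) (f≤g , g≤f) =
        (λ x x-D → D-resp-Eq k B (f-D x x-D) (f≤g x x-D , g≤f x x-D))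
      , (λ x y x-D y-D x≤y → Le-trans k B (g≤f x x-D)
                               (Le-trans k B (f-≤ x y x-D y-D x≤y) (f≤g y y-D)))

    L-respʳ-Eq : ∀ k A {d e e′} → L (suc k) A d e → Eq (suc k) A e e′ → L (suc k) A d e′
    L-respʳ-Eq k o (d-D , e-D , d≡e∩) e≈e′ =
      d-D , D-resp-Eq (suc k) o e-D e≈e′ , trans d≡e∩ (cong (_∩ Qle k) (uncurry ⊆-antisym e≈e′))
    L-respʳ-Eq k (A ⇒ B) (d-D , e-mono , d-e-L) (e≤e′ , e′≤e) =
        d-D , Mono-resp-Eq (suc k) A B e-mono (e≤e′ , e′≤e)
      , λ g₁ g₂ g-L → let g₂-D = L-upper k A g-L in
          L-respʳ-Eq k B (d-e-L g₁ g₂ g-L) (e≤e′ g₂ g₂-D , e′≤e g₂ g₂-D)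

  L-respˡ-Eq : ∀ k A {d d′ e} → L (suc k) A d e → Eq k A d d′ → L (suc k) A d′ e
  L-respˡ-Eq k o (d-D , e-D , d≡e∩) (d⊆d′ , d′⊆d) =
    D-resp-Eq k o d-D (d⊆d′ , d′⊆d) , e-D , trans (sym (⊆-antisym d⊆d′ d′⊆d)) d≡e∩
  L-respˡ-Eq k (A ⇒ B) (d-D , e-mono , d-e-L) (d≤d′ , d′≤d) =
      D-resp-Eq k (A ⇒ B) d-D (d≤d′ , d′≤d) , e-mono
    , λ g₁ g₂ g-L → let g₁-D = L-lower k A g-L in
        L-respˡ-Eq k B (d-e-L g₁ g₂ g-L) (d≤d′ g₁ g₁-D , d′≤d g₁ g₁-D)

  Eq-pointwise : ∀ k A B {f g} → (∀ x → D k A x → Eq k B (f x) (g x)) → Eq k (A ⇒ B) f g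
  Eq-pointwise k A B f≈g = (λ x x-D → proj₁ (f≈g x x-D)) , (λ x x-D → proj₂ (f≈g x x-D))

  Mono-cong : ∀ k A B {f x y} → Mono k A B f → D k A x → D k A y → Eq k A x y → Eq k B (f x) (f y)
  Mono-cong k A B (_ , f-≤) x-D y-D (x≤y , y≤x) = f-≤ _ _ x-D y-D x≤y , f-≤ _ _ y-D x-D y≤x

  Eq-trans : ∀ k A {x y z} → Eq k A x y → Eq k A y z → Eq k A x z
  Eq-trans k A (x≤y , y≤x) (y≤z , z≤y) = Le-trans k A x≤y y≤z , Le-trans k A z≤y y≤x

  fibre-closed : ∀ k A {f g y e} → L (suc k) (A ⇒ A) g f → Eq k A (g y) y →
                 L (suc k) A y e → L (suc k) A y (f e)
  fibre-closed k A (_ , _ , g-f-L) gy≈y y-e-L = L-respˡ-Eq k A (g-f-L _ _ y-e-L) gy≈y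

  -- An even stage iterates downwards from y^{↑⊤}, an odd stage upwards from y^{↑⊥}; with
  -- Le⟨ lfp ⟩ the reversed order, both compute the infimum of a descending chain.
  data Polarity : Set where
    gfp lfp : Polarity

  Le⟨_⟩ : Polarity → ℕ → (A : Ty) → Raw A → Raw A → Set
  Le⟨ gfp ⟩ k A x y = Le k A x y
  Le⟨ lfp ⟩ k A x y = Le k A y x

  Le⟨⟩-refl : ∀ p k A {x} → Le⟨ p ⟩ k A x x
  Le⟨⟩-refl gfp k A = Le-refl k A
  Le⟨⟩-refl lfp k A = Le-refl k A

  Le⟨⟩-trans : ∀ p k A {x y z} → Le⟨ p ⟩ k A x y → Le⟨ p ⟩ k A y z → Le⟨ p ⟩ k A x z
  Le⟨⟩-trans gfp k A x≤y y≤z = Le-trans k A x≤y y≤z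
  Le⟨⟩-trans lfp k A y≤x z≤y = Le-trans k A z≤y y≤x

  Le⟨⟩-pointwise : ∀ p k A B {f f′} → Le⟨ p ⟩ k (A ⇒ B) f f′ →
                   ∀ x → D k A x → Le⟨ p ⟩ k B (f x) (f′ x)
  Le⟨⟩-pointwise gfp k A B f≤f′ = f≤f′
  Le⟨⟩-pointwise lfp k A B f′≤f = f′≤f

  Le⟨⟩-antisym : ∀ p k A {x y} → Le⟨ p ⟩ k A x y × Le⟨ p ⟩ k A y x → Eq k A x y
  Le⟨⟩-antisym gfp k A = λ x≈y → x≈y
  Le⟨⟩-antisym lfp k A = swap

  Eq⇒Le⟨⟩ : ∀ p k A {x y} → Eq k A x y → Le⟨ p ⟩ k A x y × Le⟨ p ⟩ k A y x
  Eq⇒Le⟨⟩ gfp k A = λ x≈y → x≈y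
  Eq⇒Le⟨⟩ lfp k A = swap

  Mono⇒Le⟨⟩-mono : ∀ p k A {f} → Mono k A A f →
                   ∀ x y → D k A x → D k A y → Le⟨ p ⟩ k A x y → Le⟨ p ⟩ k A (f x) (f y)
  Mono⇒Le⟨⟩-mono gfp k A (_ , f-≤) = f-≤
  Mono⇒Le⟨⟩-mono lfp k A (_ , f-≤) x y x-D y-D = f-≤ y x y-D x-D

  Le-mono⇒Le⟨⟩-mono : ∀ p {k k′ A B} {R : Raw A → Raw B → Set} →
    (∀ {a a′ b b′} → R a b → R a′ b′ → Le k A a a′ → Le k′ B b b′) →
    (∀ {a a′ b b′} → R a b → R a′ b′ → Le⟨ p ⟩ k A a a′ → Le⟨ p ⟩ k′ B b b′)
  Le-mono⇒Le⟨⟩-mono gfp mono = mono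
  Le-mono⇒Le⟨⟩-mono lfp mono Rab Ra′b′ = mono Ra′b′ Rab

  Le⟨⟩-mono⇒Le-mono : ∀ p {k k′ A B} {R : Raw A → Raw B → Set} →
    (∀ {a a′ b b′} → R a b → R a′ b′ → Le⟨ p ⟩ k A a a′ → Le⟨ p ⟩ k′ B b b′) →
    (∀ {a a′ b b′} → R a b → R a′ b′ → Le k A a a′ → Le k′ B b b′)
  Le⟨⟩-mono⇒Le-mono gfp mono = mono
  Le⟨⟩-mono⇒Le-mono lfp mono Rab Ra′b′ = mono Ra′b′ Rab

  Qeq : ℕ → Subset n
  Qeq k = tabulate (λ q → does (ρ q ≟ k))

  -- down A and lift E A are e ↦ e^↓ and d ↦ d^↑ between levels k and suc k;
  -- at base type lift E adjoins E, so E = ∅ gives d^{↑⊥} and E = Qeq (suc k) gives d^{↑⊤}.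
  module Level (k : ℕ) where

    Fresh : Subset n → Set
    Fresh E = ∀ {q} → q ∈ˢ E → ρ q ≡ suc k

    ∅-fresh : Fresh ∅
    ∅-fresh q∈∅ = ⊥-elim (∉⊥ q∈∅)

    Qeq-fresh : Fresh (Qeq (suc k))
    Qeq-fresh = ∈-tabulate⁻ (λ q → ρ q ≟ suc k)

    mutual
      down : ∀ A → Raw A → Raw A
      down o       p = p ∩ Qle k
      down (A ⇒ B) f = λ g → down B (f (lift ∅ A g))

      lift : Subset n → ∀ A → Raw A → Raw A
      lift E o       r = r ∪ E
      lift E (A ⇒ B) f = λ x → lift E B (f (down A x))

    mutual
      down-L : ∀ A {e} → D (suc k) A e → L (suc k) A (down A e) e
      down-L o {p} p-D =
        D-o⁺ k (λ q q∈ → ∈-Qle⁻ (proj₂ (x∈p∩q⁻ p (Qle k) q∈))) , p-D , refl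
      down-L (A ⇒ B) (f₁ , f₁f-L) =
        L-respˡ-Eq k (A ⇒ B) f₁f-L (swap (down-Eq (A ⇒ B) f₁f-L))

      down-Eq : ∀ A {d e} → L (suc k) A d e → Eq k A (down A e) d
      down-Eq o       (_ , _ , d≡e∩) = ⊆-reflexive (sym d≡e∩) , ⊆-reflexive d≡e∩
      down-Eq (A ⇒ B) (_ , _ , d-e-L) =
        Eq-pointwise k A B λ g g-D → down-Eq B (d-e-L g (lift ∅ A g) (lift-L ∅-fresh A g-D))

      lift-L : ∀ {E} → Fresh E → ∀ A {d} → D k A d → L (suc k) A d (lift E A d)
      lift-L {E} E-fresh o {r} r-D = r-D , D-o⁺ (suc k) bounded , ⊆-antisym r⊆ ⊆r
        where
          bounded : ∀ q → q ∈ˢ r ∪ E → ρ q ≤ suc k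
          bounded q q∈ with x∈p∪q⁻ r E q∈
          ... | inj₁ q∈r = m≤n⇒m≤1+n (D-o⁻ k r-D q q∈r)
          ... | inj₂ q∈E = ≤-reflexive (E-fresh q∈E)
          r⊆ : r ⊆ (r ∪ E) ∩ Qle k
          r⊆ q∈r = x∈p∩q⁺ (x∈p∪q⁺ (inj₁ q∈r) , ∈-Qle⁺ (D-o⁻ k r-D _ q∈r))
          ⊆r : (r ∪ E) ∩ Qle k ⊆ r
          ⊆r q∈ with x∈p∩q⁻ (r ∪ E) (Qle k) q∈
          ... | q∈r∪E , q∈Q with x∈p∪q⁻ r E q∈r∪E
          ...   | inj₁ q∈r = q∈r
          ...   | inj₂ q∈E = ⊥-elim (1+n≰n (subst (ℕ._≤ k) (E-fresh q∈E)
                                                   (∈-Qle⁻ q∈Q)))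
      lift-L {E} E-fresh (A ⇒ B) {f₁} f₁-D = f₁-D , (lift-D , lift-≤) , lift-pointwise
        where
          f₁-mono = D⇒Mono k A B f₁-D
          f₁-D′ : ∀ {x} → D k A x → D k B (f₁ x)
          f₁-D′ = proj₁ f₁-mono _
          down-D : ∀ {x} → D (suc k) A x → D k A (down A x)
          down-D x-D = L-lower k A (down-L A x-D)
          lift-D : ∀ x → D (suc k) A x → D (suc k) B (lift E B (f₁ (down A x)))
          lift-D x x-D = L-upper k B (lift-L E-fresh B (f₁-D′ (down-D x-D)))
          lift-≤ : ∀ x y → D (suc k) A x → D (suc k) A y → Le (suc k) A x y →
                   Le (suc k) B (lift E B (f₁ (down A x))) (lift E B (f₁ (down A y)))
          lift-≤ x y x-D y-D x≤y =
            lift-mono E B (f₁-D′ (down-D x-D)) (f₁-D′ (down-D y-D))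
              (proj₂ f₁-mono _ _ (down-D x-D) (down-D y-D) (L-mono A (down-L A x-D) (down-L A y-D) x≤y))
          lift-pointwise : ∀ g₁ g₂ → L (suc k) A g₁ g₂ → L (suc k) B (f₁ g₁) (lift E B (f₁ (down A g₂)))
          lift-pointwise g₁ g₂ g-L =
            let g₁-D = L-lower k A g-L
                g₂↓-D = down-D (L-upper k A g-L)
                f₁g₁≈ = Mono-cong k A B f₁-mono g₁-D g₂↓-D (swap (down-Eq A g-L))
            in L-respʳ-Eq k B (lift-L E-fresh B (f₁-D′ g₁-D))
                 ( lift-mono E B (f₁-D′ g₁-D) (f₁-D′ g₂↓-D) (proj₁ f₁g₁≈)
                 , lift-mono E B (f₁-D′ g₂↓-D) (f₁-D′ g₁-D) (proj₂ f₁g₁≈))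

      L-mono : ∀ A {d e d′ e′} → L (suc k) A d e → L (suc k) A d′ e′ →
               Le (suc k) A e e′ → Le k A d d′
      L-mono o (_ , _ , d≡e∩) (_ , _ , d′≡e′∩) e⊆e′ q∈d
        with x∈p∩q⁻ _ (Qle k) (subst (_ ∈ˢ_) d≡e∩ q∈d)
      ... | q∈e , q∈Q = subst (_ ∈ˢ_) (sym d′≡e′∩) (x∈p∩q⁺ (e⊆e′ q∈e , q∈Q))
      L-mono (A ⇒ B) (_ , _ , d-e-L) (_ , _ , d′-e′-L) e≤e′ g g-D =
        let g-L = lift-L ∅-fresh A g-D in
        L-mono B (d-e-L g _ g-L) (d′-e′-L g _ g-L) (e≤e′ _ (L-upper k A g-L))

      lift-mono : ∀ E A {d d′} → D k A d → D k A d′ → Le k A d d′ →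
                  Le (suc k) A (lift E A d) (lift E A d′)
      lift-mono E o _ _ d⊆d′ q∈ with x∈p∪q⁻ _ E q∈
      ... | inj₁ q∈d = x∈p∪q⁺ (inj₁ (d⊆d′ q∈d))
      ... | inj₂ q∈E = x∈p∪q⁺ (inj₂ q∈E)
      lift-mono E (A ⇒ B) {f} {f′} f-D f′-D f≤f′ x x-D =
        let x↓-D = L-lower k A (down-L A x-D) in
        lift-mono E B (proj₁ (D⇒Mono k A B f-D) _ x↓-D) (proj₁ (D⇒Mono k A B f′-D) _ x↓-D)
                      (f≤f′ _ x↓-D)

    lift-greatest : ∀ A {d e} → L (suc k) A d e → Le (suc k) A e (lift (Qeq (suc k)) A d)
    lift-greatest o (_ , e-D , d≡e∩) {q} q∈e with ρ q ≤? k
    ... | yes ρq≤k = x∈p∪q⁺ (inj₁ (subst (q ∈ˢ_) (sym d≡e∩)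
                       (x∈p∩q⁺ (q∈e , ∈-Qle⁺ ρq≤k))))
    ... | no ρq≰k  = x∈p∪q⁺ (inj₂ (∈-tabulate⁺ (λ q → ρ q ≟ suc k)
                       (≤-antisym (e-D q q∈e) (≰⇒> ρq≰k))))
    lift-greatest (A ⇒ B) (_ , _ , d-e-L) x x-D = lift-greatest B (d-e-L _ x (down-L A x-D))

    lift-least : ∀ A {d e} → L (suc k) A d e → Le (suc k) A (lift ∅ A d) e
    lift-least o (_ , _ , d≡e∩) q∈ with x∈p∪q⁻ _ ∅ q∈
    ... | inj₁ q∈d = proj₁ (x∈p∩q⁻ _ (Qle k) (subst (_ ∈ˢ_) d≡e∩ q∈d))
    ... | inj₂ q∈∅ = ⊥-elim (∉⊥ q∈∅)
    lift-least (A ⇒ B) (_ , _ , d-e-L) x x-D = lift-least B (d-e-L _ x (down-L A x-D))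

    Mono-down : ∀ A B {f} → Mono (suc k) A B f → Mono k A B (down (A ⇒ B) f)
    Mono-down A B {f} (f-D , f-≤) = f↓-D , f↓-≤
      where
        lift-D : ∀ {g} → D k A g → D (suc k) A (lift ∅ A g)
        lift-D g-D = L-upper k A (lift-L ∅-fresh A g-D)
        f↓-D : ∀ g → D k A g → D k B (down (A ⇒ B) f g)
        f↓-D g g-D = L-lower k B (down-L B (f-D _ (lift-D g-D)))
        f↓-≤ : ∀ g g′ → D k A g → D k A g′ → Le k A g g′ →
               Le k B (down (A ⇒ B) f g) (down (A ⇒ B) f g′)
        f↓-≤ g g′ g-D g′-D g≤g′ =
          L-mono B (down-L B (f-D _ (lift-D g-D))) (down-L B (f-D _ (lift-D g′-D)))
                   (f-≤ _ _ (lift-D g-D) (lift-D g′-D) (lift-mono ∅ A g-D g′-D g≤g′))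

    Commutes : ∀ A B → Raw (A ⇒ B) → Set
    Commutes A B f = ∀ x → D (suc k) A x → Eq k B (down B (f x)) (down (A ⇒ B) f (down A x))

    D-arrow⁻ : ∀ A B {f} → D (suc k) (A ⇒ B) f → D k (A ⇒ B) (down (A ⇒ B) f) × Commutes A B f
    D-arrow⁻ A B f-D with down-L (A ⇒ B) f-D
    ... | f↓-D , _ , f↓-f-L = f↓-D , λ x x-D → down-Eq B (f↓-f-L _ x (down-L A x-D))

    D-arrow⁺ : ∀ A B {f} → Mono (suc k) A B f → D k (A ⇒ B) (down (A ⇒ B) f) →
               Commutes A B f → D (suc k) (A ⇒ B) f
    D-arrow⁺ A B {f} f-mono f↓-D commutes = down (A ⇒ B) f , f↓-D , f-mono , pointwise
      where
        pointwise : ∀ g₁ g₂ → L (suc k) A g₁ g₂ → L (suc k) B (down (A ⇒ B) f g₁) (f g₂)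
        pointwise g₁ g₂ g-L =
          let g₂-D  = L-upper k A g-L
              g₂↓-D = L-lower k A (down-L A g₂-D)
              f↓g₂↓≈f↓g₁ = Mono-cong k A B (D⇒Mono k A B f↓-D) g₂↓-D (L-lower k A g-L) (down-Eq A g-L)
          in L-respˡ-Eq k B (down-L B (proj₁ f-mono _ g₂-D))
               (Eq-trans k B (commutes g₂ g₂-D) f↓g₂↓≈f↓g₁)

    down-cong : ∀ A {x y} → D (suc k) A x → D (suc k) A y → Eq (suc k) A x y →
                Eq k A (down A x) (down A y)
    down-cong A x-D y-D (x≤y , y≤x) =
      L-mono A (down-L A x-D) (down-L A y-D) x≤y , L-mono A (down-L A y-D) (down-L A x-D) y≤x

    extension : Polarity → Subset n
    extension gfp = Qeq (suc k)
    extension lfp = ∅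

    extension-fresh : ∀ p → Fresh (extension p)
    extension-fresh gfp = Qeq-fresh
    extension-fresh lfp = ∅-fresh

    lift-extremal : ∀ p A {d e} → L (suc k) A d e → Le⟨ p ⟩ (suc k) A e (lift (extension p) A d)
    lift-extremal gfp = lift-greatest
    lift-extremal lfp = lift-least

    lift-mono⟨⟩ : ∀ p A {d d′} → D k A d → D k A d′ → Le⟨ p ⟩ k A d d′ →
                  Le⟨ p ⟩ (suc k) A (lift (extension p) A d) (lift (extension p) A d′)
    lift-mono⟨⟩ gfp A d-D d′-D = lift-mono _ A d-D d′-D
    lift-mono⟨⟩ lfp A d-D d′-D = lift-mono _ A d′-D d-D

  -- Each D^k_A is finite up to equivalence

  Member : ℕ → Ty → Set
  Member k A = Σ (Raw A) (D k A)

  record Enumeration (k : ℕ) (A : Ty) : Set where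
    field
      elements    : List (Member k A)
      complete    : ∀ {x} → D k A x → Any (Eq k A x ∘ proj₁) elements
      _≤ᵇ_        : Raw A → Raw A → Bool
      ≤ᵇ-reflects : ∀ {x y} → D k A x → D k A y → Reflects (Le k A x y) (x ≤ᵇ y)

    Le? : ∀ {x y} → D k A x → D k A y → Dec (Le k A x y)
    Le? x-D y-D = _ because ≤ᵇ-reflects x-D y-D

    _≈ᵇ_ : Raw A → Raw A → Bool
    x ≈ᵇ y = (x ≤ᵇ y) ∧ (y ≤ᵇ x)

    ≈ᵇ-reflects : ∀ {x y} → D k A x → D k A y → Reflects (Eq k A x y) (x ≈ᵇ y)
    ≈ᵇ-reflects x-D y-D = ≤ᵇ-reflects x-D y-D ×-reflects ≤ᵇ-reflects y-D x-D

    Eq? : ∀ {x y} → D k A x → D k A y → Dec (Eq k A x y)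
    Eq? x-D y-D = _ because ≈ᵇ-reflects x-D y-D

    ≈ᵇ-resp-Eq : ∀ {x x′ y} → D k A x → D k A x′ → D k A y → Eq k A x x′ → x ≈ᵇ y ≡ x′ ≈ᵇ y
    ≈ᵇ-resp-Eq x-D x′-D y-D x≈x′ =
      reflects-cong (≈ᵇ-reflects x-D y-D) (≈ᵇ-reflects x′-D y-D)
        (Eq-trans k A (swap x≈x′)) (Eq-trans k A x≈x′)

    decide-∀ : (Q : Raw A → Set) → (∀ {x y} → D k A x → D k A y → Eq k A x y → Q x → Q y) →
               (∀ {x} → D k A x → Dec (Q x)) → Dec (∀ x → D k A x → Q x)
    decide-∀ Q Q-resp Q? = map′ everywhere on-elements (All.all? (Q? ∘ proj₂) elements)
      where
        everywhere : All (Q ∘ proj₁) elements → ∀ x → D k A x → Q x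
        everywhere all-elements x x-D with find (complete x-D)
        ... | (e , e-D) , e∈ , x≈e = Q-resp e-D x-D (swap x≈e) (All.lookup all-elements e∈)
        on-elements : (∀ x → D k A x → Q x) → All (Q ∘ proj₁) elements
        on-elements Q-all = All.tabulate λ {e} _ → Q-all (proj₁ e) (proj₂ e)

  enumerate-o : ∀ k → Enumeration k o
  enumerate-o k = record
    { elements    = List.map (λ r → r ∩ Qle k , restrict-D r) (subsets n)
    ; complete    = λ {x} x-D → map⁺ (Any.map (λ { refl → restrict-Eq x-D }) (∈-subsets x))
    ; _≤ᵇ_        = λ r r′ → does (r ⊆? r′)
    ; ≤ᵇ-reflects = λ {r} {r′} _ _ → proof (r ⊆? r′)
    }
    where
      restrict-D : ∀ r → D k o (r ∩ Qle k)
      restrict-D r = D-o⁺ k λ q q∈ → ∈-Qle⁻ (proj₂ (x∈p∩q⁻ r (Qle k) q∈))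
      restrict-Eq : ∀ {r} → D k o r → Eq k o r (r ∩ Qle k)
      restrict-Eq {r} r-D =
          (λ q∈ → x∈p∩q⁺ (q∈ , ∈-Qle⁺ (D-o⁻ k r-D _ q∈)))
        , p∩q⊆p r (Qle k)

  default : ∀ A → Raw A
  default o       = ∅
  default (A ⇒ B) = λ _ → default B

  module Tabulation {k A} (enumA : Enumeration k A) (B : Ty) where
    open Enumeration enumA

    -- default B is junk: for x ∈ D k A some element is always equivalent to x.
    tabulated : (Fin (length elements) → Raw B) → Raw (A ⇒ B)
    tabulated T x = Maybe.maybe′ T (default B) (findIndexᵇ ((x ≈ᵇ_) ∘ proj₁) elements)

    tabulated-lookup : ∀ T {x} → D k A x →
                       ∃ λ i → tabulated T x ≡ T i × Eq k A x (proj₁ (List.lookup elements i))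
    tabulated-lookup T {x} x-D
      with findIndexᵇ-just ((x ≈ᵇ_) ∘ proj₁)
             (Any.map (λ {e} → Reflects-T⁺ (≈ᵇ-reflects x-D (proj₂ e))) (complete x-D))
    ... | i , found , x≈ᵇe =
      i , cong (Maybe.maybe′ T (default B)) found
        , Reflects-T⁻ (≈ᵇ-reflects x-D (proj₂ (List.lookup elements i))) x≈ᵇe

    tabulated-resp-Eq : ∀ T {x x′} → D k A x → D k A x′ → Eq k A x x′ →
                        tabulated T x ≡ tabulated T x′
    tabulated-resp-Eq T x-D x′-D x≈x′ =
      cong (Maybe.maybe′ T (default B))
           (findIndexᵇ-cong _ _ {elements} (All.tabulate λ {e} _ → ≈ᵇ-resp-Eq x-D x′-D (proj₂ e) x≈x′))

  module ArrowEnumeration (A B : Ty) (enumA : ∀ k → Enumeration k A)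
                          (enumB : ∀ k → Enumeration k B) where

    D? : ∀ k {f} → Mono k A B f → Dec (D k (A ⇒ B) f)
    D? zero    f-mono     = yes f-mono
    D? (suc k) {f} f-mono =
      map′ (uncurry (D-arrow⁺ A B f-mono)) (D-arrow⁻ A B)
           (D? k f↓-mono ×-dec Enumeration.decide-∀ (enumA (suc k)) Q Q-resp Q?)
      where
        open Level k
        f↓-mono = Mono-down A B f-mono
        Q : Raw A → Set
        Q x = Eq k B (down B (f x)) (down (A ⇒ B) f (down A x))
        f-D : ∀ {x} → D (suc k) A x → D (suc k) B (f x)
        f-D = proj₁ f-mono _
        down-D : ∀ C {x} → D (suc k) C x → D k C (down C x)
        down-D C x-D = L-lower k C (down-L C x-D)
        Q? : ∀ {x} → D (suc k) A x → Dec (Q x)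
        Q? x-D = Enumeration.Eq? (enumB k) (down-D B (f-D x-D)) (proj₁ f↓-mono _ (down-D A x-D))
        Q-resp : ∀ {x y} → D (suc k) A x → D (suc k) A y → Eq (suc k) A x y → Q x → Q y
        Q-resp x-D y-D x≈y Qx =
          Eq-trans k B
            (down-cong B (f-D y-D) (f-D x-D) (Mono-cong (suc k) A B f-mono y-D x-D (swap x≈y)))
            (Eq-trans k B Qx
              (Mono-cong k A B f↓-mono (down-D A x-D) (down-D A y-D) (down-cong A x-D y-D x≈y)))

    module _ (k : ℕ) where
      open Enumeration (enumA k) using (Le?)
        renaming (elements to elementsA; complete to completeA; decide-∀ to decide-∀A)
      open Enumeration (enumB k) using ()
        renaming ( elements to elementsB; complete to completeB
                 ; _≤ᵇ_ to _≤ᵇB_; ≤ᵇ-reflects to ≤ᵇB-reflects)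
      open Tabulation (enumA k) B

      -- An index codes a map Fin |elementsA| → Fin |elementsB| (Fin (b ^ a) ≅ (Fin a → Fin b)).
      Index : Set
      Index = Fin (length elementsB ^ length elementsA)

      table : Index → Fin (length elementsA) → Raw B
      table i j = proj₁ (List.lookup elementsB (finToFun i j))

      candidate : Index → Raw (A ⇒ B)
      candidate i = tabulated (table i)

      candidate-D : ∀ i {x} → D k A x → D k B (candidate i x)
      candidate-D i x-D with tabulated-lookup (table i) x-D
      ... | j , value , _ = subst (D k B) (sym value) (proj₂ (List.lookup elementsB (finToFun i j)))

      candidate-Mono? : ∀ i → Dec (Mono k A B (candidate i))
      candidate-Mono? i =
        map′ (λ mono → (λ _ → candidate-D i) , λ x y x-D y-D → mono x x-D y y-D)
             (λ (_ , mono) x x-D y y-D → mono x y x-D y-D)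
             (decide-∀A _ resp-x λ x-D → decide-∀A _ (resp-y x-D) λ y-D →
                Le? x-D y-D →-dec Enumeration.Le? (enumB k) (candidate-D i x-D) (candidate-D i y-D))
        where
          F = candidate i
          resp-x : ∀ {x x′} → D k A x → D k A x′ → Eq k A x x′ →
                   (∀ y → D k A y → Le k A x y → Le k B (F x) (F y)) →
                   (∀ y → D k A y → Le k A x′ y → Le k B (F x′) (F y))
          resp-x x-D x′-D x≈x′ mono y y-D x′≤y =
            subst (λ z → Le k B z (F y)) (tabulated-resp-Eq (table i) x-D x′-D x≈x′)
                  (mono y y-D (Le-trans k A (proj₁ x≈x′) x′≤y))
          resp-y : ∀ {x} → D k A x → ∀ {y y′} → D k A y → D k A y′ → Eq k A y y′ →
                   (Le k A x y → Le k B (F x) (F y)) → (Le k A x y′ → Le k B (F x) (F y′))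
          resp-y x-D y-D y′-D y≈y′ mono x≤y′ =
            subst (Le k B (F _)) (tabulated-resp-Eq (table i) y-D y′-D y≈y′)
                  (mono (Le-trans k A x≤y′ (proj₂ y≈y′)))

      candidate-D? : ∀ i → Dec (D k (A ⇒ B) (candidate i))
      candidate-D? i with candidate-Mono? i
      ... | yes mono = D? k mono
      ... | no ¬mono = no (¬mono ∘ D⇒Mono k A B)

      elements : List (Member k (A ⇒ B))
      elements = List.map (λ (i , i-D) → candidate i , i-D) (select candidate-D? (List.allFin _))

      complete : ∀ {f} → D k (A ⇒ B) f → Any (Eq k (A ⇒ B) f ∘ proj₁) elements
      complete {f} f-D =
        map⁺ (Any.map (λ { refl → f≈F })
                      (select-complete candidate-D? (∈-allFin i) (D-resp-Eq k (A ⇒ B) f-D f≈F)))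
        where
          f-mono = D⇒Mono k A B f-D
          f-D′ : ∀ {x} → D k A x → D k B (f x)
          f-D′ = proj₁ f-mono _
          t : Fin (length elementsA) → Fin (length elementsB)
          t j = Any.index (completeB (f-D′ (proj₂ (List.lookup elementsA j))))
          i : Index
          i = funToFin t
          f≈F : Eq k (A ⇒ B) f (candidate i)
          f≈F = Eq-pointwise k A B λ x x-D →
            let j , value , x≈e = tabulated-lookup (table i) x-D
            in subst (Eq k B (f x))
                 (trans (cong (λ l → proj₁ (List.lookup elementsB l)) (sym (finToFun-funToFin t j)))
                        (sym value))
                 (Eq-trans k B (Mono-cong k A B f-mono x-D (proj₂ (List.lookup elementsA j)) x≈e)
                               (lookup-index (completeB (f-D′ (proj₂ (List.lookup elementsA j))))))

      pointwise? : (f g : Raw (A ⇒ B)) → Dec (All (λ e → T (f (proj₁ e) ≤ᵇB g (proj₁ e))) elementsA)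
      pointwise? f g = All.all? (λ e → T? (f (proj₁ e) ≤ᵇB g (proj₁ e))) elementsA

      ≤ᵇ-reflects : ∀ {f g} → D k (A ⇒ B) f → D k (A ⇒ B) g →
                    Reflects (Le k (A ⇒ B) f g) (does (pointwise? f g))
      ≤ᵇ-reflects {f} {g} f-D g-D = proof (map′ everywhere on-elements (pointwise? f g))
        where
          f-mono = D⇒Mono k A B f-D
          g-mono = D⇒Mono k A B g-D
          everywhere : All (λ e → T (f (proj₁ e) ≤ᵇB g (proj₁ e))) elementsA → Le k (A ⇒ B) f g
          everywhere all-elements x x-D with find (completeA x-D)
          ... | (e , e-D) , e∈ , (x≤e , e≤x) =
            Le-trans k B (proj₂ f-mono _ _ x-D e-D x≤e)
              (Le-trans k B (Reflects-T⁻ (≤ᵇB-reflects (proj₁ f-mono _ e-D) (proj₁ g-mono _ e-D))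
                                         (All.lookup all-elements e∈))
                            (proj₂ g-mono _ _ e-D x-D e≤x))
          on-elements : Le k (A ⇒ B) f g → All (λ e → T (f (proj₁ e) ≤ᵇB g (proj₁ e))) elementsA
          on-elements f≤g = All.tabulate λ {(e , e-D)} _ →
            Reflects-T⁺ (≤ᵇB-reflects (proj₁ f-mono _ e-D) (proj₁ g-mono _ e-D)) (f≤g e e-D)

      enumeration : Enumeration k (A ⇒ B)
      enumeration = record
        { elements    = elements
        ; complete    = complete
        ; _≤ᵇ_        = λ f g → does (pointwise? f g)
        ; ≤ᵇ-reflects = ≤ᵇ-reflects
        }

  enumerate : ∀ A k → Enumeration k A
  enumerate o       = enumerate-o
  enumerate (A ⇒ B) = ArrowEnumeration.enumeration A B (enumerate A) (enumerate B)

  -- The fixpoint stages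

  module Chains (p : Polarity) (k : ℕ) (A : Ty) where
    open Iterates (D k A) (Le⟨ p ⟩ k A) (Le⟨⟩-refl p k A) (Le⟨⟩-trans p k A) public
    open Enumeration (enumerate A k) using (elements; complete)

    Mono⇒Monotone : ∀ {f} → Mono k A A f → Monotone f
    Mono⇒Monotone f-mono = proj₁ f-mono , Mono⇒Le⟨⟩-mono p k A f-mono

    complete⟨⟩ : ∀ {x} → D k A x → Any (x ≈_) (List.map proj₁ elements)
    complete⟨⟩ x-D = map⁺ (Any.map (Eq⇒Le⟨⟩ p k A) (complete x-D))

    module Iteration {f u} (f-mono : Monotone f) (u-D : D k A u) (fu≤u : Le⟨ p ⟩ k A (f u) u) where
      open Descending f-mono u-D fu≤u public
      open Stabilisation (List.map proj₁ elements) complete⟨⟩ public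

  record IsFixpointOperator (k : ℕ) (Fix : (A : Ty) → Raw (A ⇒ A) → Raw A → Set) : Set where
    field
      fix-exists : ∀ {A f} → D k (A ⇒ A) f → Σ (Raw A) (Fix A f)
      fix-fixed  : ∀ {A f x} → D k (A ⇒ A) f → Fix A f x → D k A x × Eq k A (f x) x
      fix-mono   : ∀ {A f f′ x x′} → D k (A ⇒ A) f → D k (A ⇒ A) f′ → Le k (A ⇒ A) f f′ →
                   Fix A f x → Fix A f′ x′ → Le k A x x′

  module Step (p : Polarity) (K : ℕ) {Fix₀ : (A : Ty) → Raw (A ⇒ A) → Raw A → Set}
              (fix₀ : IsFixpointOperator K Fix₀) where
    open IsFixpointOperator fix₀
    open Level K

    -- Unfolds to IsFixE (suc j) for p = gfp, K = 1 + 2 * j and to IsFixO j for p = lfp, K = 2 * j.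
    Fix : (A : Ty) → Raw (A ⇒ A) → Raw A → Set
    Fix A f x = Σ (Raw (A ⇒ A)) λ g → Σ (Raw A) λ y → Σ (Raw A) λ u →
      L (suc K) (A ⇒ A) g f × Fix₀ A g y
      × (L (suc K) A y u × (∀ e → L (suc K) A y e → Le⟨ p ⟩ (suc K) A e u))
      × Chains.Infimum p (suc K) A (λ i → iter i f u) x

    module Witness {A f g y u} (f-D : D (suc K) (A ⇒ A) f) (g-f-L : L (suc K) (A ⇒ A) g f)
               (fix₀-g-y : Fix₀ A g y) (y-u-L : L (suc K) A y u)
               (u-extremal : ∀ e → L (suc K) A y e → Le⟨ p ⟩ (suc K) A e u) where
      g-D : D K (A ⇒ A) g
      g-D = L-lower K (A ⇒ A) g-f-L

      y-D : D K A y
      y-D = proj₁ (fix-fixed g-D fix₀-g-y)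

      f-preserves-fibre : ∀ {e} → L (suc K) A y e → L (suc K) A y (f e)
      f-preserves-fibre = fibre-closed K A g-f-L (proj₂ (fix-fixed g-D fix₀-g-y))

      u-D : D (suc K) A u
      u-D = L-upper K A y-u-L

      open Chains p (suc K) A public
      f-mono : Monotone f
      f-mono = Mono⇒Monotone (D⇒Mono (suc K) A A f-D)

      open Iteration f-mono u-D (u-extremal _ (f-preserves-fibre y-u-L)) public

    exists : ∀ {A f} → D (suc K) (A ⇒ A) f → Σ (Raw A) (Fix A f)
    exists {A} {f} f-D@(g , g-f-L) =
      proj₁ infimum-exists , g , y , u , g-f-L , fix₀-g-y , (y-u-L , u-extremal) , proj₂ infimum-exists
      where
        y = proj₁ (fix-exists (L-lower K (A ⇒ A) g-f-L))
        fix₀-g-y = proj₂ (fix-exists (L-lower K (A ⇒ A) g-f-L))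
        u = lift (extension p) A y
        y-u-L = lift-L (extension-fresh p) A (proj₁ (fix-fixed (L-lower K (A ⇒ A) g-f-L) fix₀-g-y))
        u-extremal : ∀ e → L (suc K) A y e → Le⟨ p ⟩ (suc K) A e u
        u-extremal _ = lift-extremal p A
        open Witness f-D g-f-L fix₀-g-y y-u-L u-extremal

    fixed : ∀ {A f x} → D (suc K) (A ⇒ A) f → Fix A f x → D (suc K) A x × Eq (suc K) A (f x) x
    fixed {A} f-D (_ , _ , _ , g-f-L , fix₀-g-y , (y-u-L , u-extremal) , infimum) =
      proj₁ infimum , Le⟨⟩-antisym p (suc K) A (infimum-fixed infimum)
      where open Witness f-D g-f-L fix₀-g-y y-u-L u-extremal

    mono⟨⟩ : ∀ {A f f′ x x′} → D (suc K) (A ⇒ A) f → D (suc K) (A ⇒ A) f′ →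
             Le⟨ p ⟩ (suc K) (A ⇒ A) f f′ → Fix A f x → Fix A f′ x′ → Le⟨ p ⟩ (suc K) A x x′
    mono⟨⟩ {A} f-D f′-D f≤f′
      (g  , y  , u  , g-f-L   , fix₀-g-y   , (y-u-L   , u-extremal)  , infimum)
      (g′ , y′ , u′ , g′-f′-L , fix₀-g′-y′ , (y′-u′-L , u′-extremal) , infimum′) =
      Infimum-mono (iterate-mono f-mono W′.f-mono u-D W′.u-D (Le⟨⟩-pointwise p (suc K) A A f≤f′) u≤u′)
                   infimum infimum′
      where
        open Witness f-D g-f-L fix₀-g-y y-u-L u-extremal
        module W′ = Witness f′-D g′-f′-L fix₀-g′-y′ y′-u′-L u′-extremal
        g≤g′ : Le⟨ p ⟩ K (A ⇒ A) g g′
        g≤g′ = Le-mono⇒Le⟨⟩-mono p {R = λ e d → L (suc K) (A ⇒ A) d e} (L-mono (A ⇒ A))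
                 g-f-L g′-f′-L f≤f′
        y≤y′ : Le⟨ p ⟩ K A y y′
        y≤y′ = Le-mono⇒Le⟨⟩-mono p {R = λ h z → D K (A ⇒ A) h × Fix₀ A h z}
                 (λ (h-D , fix) (h′-D , fix′) h≤h′ → fix-mono h-D h′-D h≤h′ fix fix′)
                 (g-D , fix₀-g-y) (W′.g-D , fix₀-g′-y′) g≤g′
        u≤u′ : Le⟨ p ⟩ (suc K) A u u′
        u≤u′ = Le⟨⟩-trans p (suc K) A (lift-extremal p A y-u-L)
                 (Le⟨⟩-trans p (suc K) A (lift-mono⟨⟩ p A y-D W′.y-D y≤y′)
                   (u′-extremal _ (lift-L (extension-fresh p) A W′.y-D)))

    isFixpointOperator : IsFixpointOperator (suc K) Fix
    isFixpointOperator = record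
      { fix-exists = exists
      ; fix-fixed  = fixed
      ; fix-mono   = λ {A} f-D f′-D f≤f′ fix fix′ →
          Le⟨⟩-mono⇒Le-mono p {R = λ f x → D (suc K) (A ⇒ A) f × Fix A f x}
            (λ (f-D , fix) (f′-D , fix′) f≤f′ → mono⟨⟩ f-D f′-D f≤f′ fix fix′)
            (f-D , fix) (f′-D , fix′) f≤f′
      }

    PostfixpointOver : ∀ {A} → Raw (A ⇒ A) → Raw A → Raw A → Set
    PostfixpointOver {A} f y d =
      Le⟨ p ⟩ (suc K) A d (f d) × Σ (Raw A) λ d′ → L (suc K) A d′ d × Eq K A d′ y

    characterisation :
      ∀ {A f x g y} → D (suc K) (A ⇒ A) f → Fix A f x → L (suc K) (A ⇒ A) g f → Fix₀ A g y →
      Chains.Supremum p (suc K) A (PostfixpointOver f y) x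
    characterisation {A} {f} {x} {g} {y} f-D
      (g′ , y′ , u , g′-f-L , fix₀-g′-y′ , (y′-u-L , u-extremal) , infimum) g-f-L fix₀-g-y =
      proj₁ infimum , upper , least
      where
        open Witness f-D g′-f-L fix₀-g′-y′ y′-u-L u-extremal renaming (g-D to g′-D)
        g≤g′ = L-mono (A ⇒ A) g-f-L g′-f-L (Le-refl (suc K) (A ⇒ A))
        g′≤g = L-mono (A ⇒ A) g′-f-L g-f-L (Le-refl (suc K) (A ⇒ A))
        g-D = L-lower K (A ⇒ A) g-f-L
        y≈y′ : Eq K A y y′
        y≈y′ = fix-mono g-D g′-D g≤g′ fix₀-g-y fix₀-g′-y′ , fix-mono g′-D g-D g′≤g fix₀-g′-y′ fix₀-g-y
        upper : ∀ d → D (suc K) A d → PostfixpointOver f y d → Le⟨ p ⟩ (suc K) A d x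
        upper d d-D (d≤fd , d′ , d′-d-L , d′≈y) =
          proj₂ (proj₂ infimum) d d-D
            (below-iterates d-D (u-extremal d (L-respˡ-Eq K A d′-d-L (Eq-trans K A d′≈y y≈y′))) d≤fd)
        y′-x-L : L (suc K) A y′ x
        y′-x-L = infimum-induction (L (suc K) A y′)
                   (λ e≈e′ y′-e-L → L-respʳ-Eq K A y′-e-L (Le⟨⟩-antisym p (suc K) A e≈e′))
                   y′-u-L (λ _ → f-preserves-fibre) infimum
        least : ∀ z → D (suc K) A z →
                (∀ d → D (suc K) A d → PostfixpointOver f y d → Le⟨ p ⟩ (suc K) A d z) →
                Le⟨ p ⟩ (suc K) A x z
        least z _ z-upper =
          z-upper x (proj₁ infimum) (proj₂ (infimum-fixed infimum) , y′ , y′-x-L , swap y≈y′)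

  top : ∀ A → Raw A
  top o       = Qle 0
  top (A ⇒ B) = λ _ → top B

  top-D : ∀ A → D 0 A (top A)
  top-D o       = λ q q∈ → n≤0⇒n≡0 (∈-Qle⁻ q∈)
  top-D (A ⇒ B) = (λ _ _ → top-D B) , (λ _ _ _ _ _ → Le-refl 0 B)

  top-greatest : ∀ A {x} → D 0 A x → Le 0 A x (top A)
  top-greatest o       x-D q∈    = ∈-Qle⁺ (≤-reflexive (x-D _ q∈))
  top-greatest (A ⇒ B) f-D x x-D = top-greatest B (proj₁ f-D x x-D)

  fix⁰ : IsFixpointOperator 0 (IsFixE 0)
  fix⁰ = record { fix-exists = exists ; fix-fixed = fixed ; fix-mono = mono }
    where
      open module C A = Chains gfp 0 A using (Infimum-mono; iterate-mono)
      module I A = C.Iteration A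
      exists : ∀ {A f} → D 0 (A ⇒ A) f → Σ (Raw A) (IsFixE 0 A f)
      exists {A} f-D =
        let x , infimum = I.infimum-exists A f-D (top-D A) (top-greatest A (proj₁ f-D _ (top-D A)))
        in x , top A , (top-D A , λ _ → top-greatest A) , infimum
      fixed : ∀ {A f x} → D 0 (A ⇒ A) f → IsFixE 0 A f x → D 0 A x × Eq 0 A (f x) x
      fixed {A} f-D (t , (t-D , t-top) , infimum) =
        proj₁ infimum , I.infimum-fixed A f-D t-D (t-top _ (proj₁ f-D _ t-D)) infimum
      mono : ∀ {A f f′ x x′} → D 0 (A ⇒ A) f → D 0 (A ⇒ A) f′ → Le 0 (A ⇒ A) f f′ →
             IsFixE 0 A f x → IsFixE 0 A f′ x′ → Le 0 A x x′
      mono {A} f-D f′-D f≤f′ (t , (t-D , _) , infimum) (t′ , (t′-D , t′-top) , infimum′) =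
        Infimum-mono A (iterate-mono A f-D f′-D t-D t′-D f≤f′ (t′-top _ t-D)) infimum infimum′

  mutual
    fix-even : ∀ k → IsFixpointOperator (2 * k) (IsFixE k)
    fix-even zero    = fix⁰
    fix-even (suc k) = subst (λ l → IsFixpointOperator l (IsFixE (suc k))) (sym (*-suc 2 k))
                             (Step.isFixpointOperator gfp (1 + 2 * k) (fix-odd k))

    fix-odd : ∀ k → IsFixpointOperator (1 + 2 * k) (IsFixO k)
    fix-odd k = Step.isFixpointOperator lfp (2 * k) (fix-even k)

corollary4p9 : (n : ℕ) (ρ : Fin n → ℕ) (m : ℕ)
    → (∀ q → ρ q ≤ m) → Σ (Fin n) (λ q → ρ q ≡ m)
    → (A : Ty) (j : ℕ)
    → let open Domain n ρ in
      ((2 + 2 * j ≤ m) → (f : Raw (A ⇒ A)) → D (2 + 2 * j) (A ⇒ A) f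
        → Σ (Raw A) (λ x → IsFixE (suc j) A f x)
          × (∀ x g y → IsFixE (suc j) A f x
              → IsDown (2 + 2 * j) (A ⇒ A) f g → IsFixO j A g y
              → IsLub (2 + 2 * j) A
                  (λ d → Le (2 + 2 * j) A d (f d)
                         × Σ (Raw A) (λ d' → IsDown (2 + 2 * j) A d d'
                                             × Eq (1 + 2 * j) A d' y))
                  x))
      ×
      ((1 + 2 * suc j ≤ m) → (f : Raw (A ⇒ A)) → D (1 + 2 * suc j) (A ⇒ A) f
        → Σ (Raw A) (λ x → IsFixO (suc j) A f x)
          × (∀ x g y → IsFixO (suc j) A f x
              → IsDown (1 + 2 * suc j) (A ⇒ A) f g → IsFixE (suc j) A g y
              → IsGlb (1 + 2 * suc j) A
                  (λ d → Le (1 + 2 * suc j) A (f d) d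
                         × Σ (Raw A) (λ d' → IsDown (1 + 2 * suc j) A d d'
                                             × Eq (2 + 2 * j) A d' y))
                  x))
corollary4p9 n ρ _ _ _ A j =
    (λ _ f f-D → Even.exists f-D , λ _ _ _ → Even.characterisation f-D)
  , (λ _ f f-D → Odd.exists f-D , λ x g y fix g-f-L fix₀ →
       subst (λ l → IsGlb (1 + 2 * suc j) A
                       (λ d → Le (1 + 2 * suc j) A (f d) d
                              × Σ (Raw A) (λ d′ → IsDown (1 + 2 * suc j) A d d′ × Eq l A d′ y)) x)
             (*-suc 2 j) (Odd.characterisation f-D fix g-f-L fix₀))
  where
    open Domain n ρ
    open Hierarchy n ρ
    module Even = Step gfp (1 + 2 * j) (fix-odd j)
    module Odd  = Step lfp (2 * suc j) (fix-even (suc j))
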